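{- For $k\ge1$ and $n\ge0$, $x_k[n]=\min(k,1+\mathrm{rank}_k(n))$.
   Context: For $k\ge1$, $\tau_k$ is the substitution on the alphabet $\{1,\ldots,k\}$ given by $\tau_k(k)=k1$ and $\tau_k(i)=i+1$ for $1\le i<k$, and $x_k=x_k[0]x_k[1]\cdots$ is the infinite fixed point of $\tau_k$ (starting with the letter $k$), positions indexed from $0$. The sequence $(A_{k,p})_{p\ge0}$ is defined by $A_{k,p}=p+1$ for $0\le p<k$ and $A_{k,p}=A_{k,p-1}+A_{k,p-k}$ for $p\ge k$. For $n\ge0$, $D_k(n)$ denotes the unique finite set $D\subset\mathbb{N}$ whose elements are pairwise at distance at least $k$ and such that $\sum_{p\in D}A_{k,p}=n$; $\mathrm{rank}_k(n)$ is the least element of $D_k(n)$, or $+\infty$ if $n=0$. -}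

module Defs where

open import Data.Nat using (ℕ; zero; suc; _+_; _∸_; _≤_; _<_; _⊓_; _≟_; _<ᵇ_)
open import Data.Bool using (if_then_else_)
open import Data.List using (List; []; _∷_; concatMap; map)
open import Data.Nat.ListAction using (sum)
open import Relation.Binary.PropositionalEquality using (_≡_)
open import Relation.Nullary.Decidable using (does)
open import Data.Unit using (⊤)
open import Data.Product using (_×_)

-- The substitution τ_k on letters (letters are naturals 1..k):
-- τ_k(k) = k 1 and τ_k(i) = i+1 for i < k.
τ : ℕ → ℕ → List ℕ
τ k i = if does (i ≟ k) then k ∷ 1 ∷ [] else suc i ∷ []

τw : ℕ → List ℕ → List ℕ
τw k w = concatMap (τ k) w

iter : ℕ → ℕ → List ℕ
iter k zero = k ∷ []
iter k (suc m) = τw k (iter k m)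

-- n-th letter of a word (0-indexed; default 0 when out of range)
nth : List ℕ → ℕ → ℕ
nth [] _ = 0
nth (a ∷ w) zero = a
nth (a ∷ w) (suc n) = nth w n

-- x_k[n]: the fixed point of τ_k starting with k is the limit of the words
-- τ_k^m(k), each a prefix of the next; τ_k^(n+1)(k) has length ≥ n+2,
-- so its n-th letter is x_k[n].
x : ℕ → ℕ → ℕ
x k n = nth (iter k (suc n)) n

-- A_{k,p} computed with fuel (fuel p+1 suffices when k ≥ 1):
-- A_{k,p} = p+1 for p < k, A_{k,p} = A_{k,p-1} + A_{k,p-k} for p ≥ k.
Af : ℕ → ℕ → ℕ → ℕ
Af zero k p = 0
Af (suc f) k p = if p <ᵇ k then suc p else Af f k (p ∸ 1) + Af f k (p ∸ k)

A : ℕ → ℕ → ℕ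
A k p = Af (suc p) k p

-- Finite sets D ⊂ ℕ with pairwise distances ≥ k, represented as strictly
-- increasing lists whose consecutive elements differ by at least k.
Gapped : ℕ → List ℕ → Set
Gapped k [] = ⊤
Gapped k (a ∷ []) = ⊤
Gapped k (a ∷ b ∷ w) = (a + k ≤ b) × Gapped k (b ∷ w)

Rep : ℕ → ℕ → List ℕ → Set
Rep k n D = Gapped k D × (sum (map (A k) D) ≡ n)

-- min(k, 1 + rank_k(n)) where rank_k(n) is the least element of D
-- (the head of the increasing list), +∞ if D is empty.
minRank : ℕ → List ℕ → ℕ
minRank k [] = k
minRank k (p ∷ _) = k ⊓ suc p

-- Write u_q = τ_k^q(k).  Since τ_k(k) = k 1, we have u_{q+1} = u_q τ_k^q(1), and
-- τ_k^q(1) is the single letter q+1 while q < k-1, and u_{q-k+1} afterwards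
-- (because τ_k^(k-1)(1) = k).  Hence |u_q| = A_{k,q}, x_k[A_{k,q}] = min(k, q+1), and
-- x_k[A_{k,q} + m] = x_k[m] for q ≥ k-1 and m < A_{k,q-k+1}.  The gap condition on a
-- representation D of n says exactly that the terms above the least element d of D
-- can be peeled off from the top one at a time by this shift rule, leaving
-- x_k[n] = x_k[A_{k,d}].  Existence of a representation is the greedy algorithm.
module Submission where

open import Defs
open import Data.Nat using (ℕ; zero; suc; _+_; _∸_; _<_; _≤_; _≤′_; ≤′-refl; ≤′-step; _⊓_; _≟_; _<ᵇ_; z≤n; s≤s; s≤s⁻¹; _≤?_; _<?_)
open import Data.Nat.Properties
open import Data.Nat.Induction using (<-rec)
open import Data.Bool using (true; false)
open import Data.List using (List; []; _∷_; _++_; length; map)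
open import Data.List.Properties using (length-++; map-++; concatMap-++; ++-assoc; ++-identityʳ)
open import Data.Nat.ListAction using (sum)
open import Data.Nat.ListAction.Properties using (sum-++)
open import Data.List.Relation.Unary.All as All using (All; []; _∷_)
open import Data.List.Relation.Unary.All.Properties using (++⁺)
open import Data.Product using (Σ; ∃; _×_; _,_)
open import Data.Unit using (tt)
open import Data.Sum using (inj₁; inj₂)
open import Relation.Nullary using (yes; no)
open import Relation.Nullary.Decidable using (dec-true; dec-false)
open import Relation.Binary.PropositionalEquality using (_≡_; refl; sym; trans; cong; cong₂; _≢_; module ≡-Reasoning)

module _ (k' : ℕ) where

  private
    k : ℕ
    k = suc k'

  Af-fuel-irrelevant : ∀ {f g} p → p < f → p < g → Af f k p ≡ Af g k p
  Af-fuel-irrelevant {suc f} {suc g} zero _ _ = refl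
  Af-fuel-irrelevant {suc f} {suc g} (suc p) (s≤s p<f) (s≤s p<g) with suc p <ᵇ k
  ... | true  = refl
  ... | false = cong₂ _+_ (Af-fuel-irrelevant p p<f p<g)
                  (Af-fuel-irrelevant (p ∸ k') (≤-<-trans (m∸n≤m p k') p<f) (≤-<-trans (m∸n≤m p k') p<g))

  A-< : ∀ {p} → p < k → A k p ≡ suc p
  A-< {p} p<k rewrite dec-true (p <? k) p<k = refl

  A-suc-< : ∀ {r} → r < k' → A k (suc r) ≡ suc (A k r)
  A-suc-< r<k' = trans (A-< (s≤s r<k')) (cong suc (sym (A-< (m<n⇒m<1+n r<k'))))

  A-suc-≥ : ∀ {r} → k' ≤ r → A k (suc r) ≡ A k r + A k (r ∸ k')
  A-suc-≥ {r} k'≤r rewrite dec-false (r <? k') (≤⇒≯ k'≤r) =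
    cong (A k r +_) (Af-fuel-irrelevant (r ∸ k') (s≤s (m∸n≤m r k')) ≤-refl)

  A-≤-suc : ∀ r → A k r ≤ A k (suc r)
  A-≤-suc r with k' ≤? r
  ... | yes k'≤r rewrite A-suc-≥ k'≤r = m≤m+n (A k r) _
  ... | no r≱k'  rewrite A-suc-< (≰⇒> r≱k') = n≤1+n (A k r)

  A-positive : ∀ p → 0 < A k p
  A-positive zero    = s≤s z≤n
  A-positive (suc p) = <-≤-trans (A-positive p) (A-≤-suc p)

  A-<-suc : ∀ r → A k r < A k (suc r)
  A-<-suc r with k' ≤? r
  ... | yes k'≤r rewrite A-suc-≥ k'≤r = m<m+n (A k r) (A-positive (r ∸ k'))
  ... | no r≱k'  rewrite A-suc-< (≰⇒> r≱k') = n<1+n (A k r)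

  A-mono-≤ : ∀ {i j} → i ≤ j → A k i ≤ A k j
  A-mono-≤ i≤j = go (≤⇒≤′ i≤j)
    where
    go : ∀ {i j} → i ≤′ j → A k i ≤ A k j
    go ≤′-refl     = ≤-refl
    go (≤′-step h) = ≤-trans (go h) (A-≤-suc _)

  A-mono-< : ∀ {i j} → i < j → A k i < A k j
  A-mono-< {i} i<j = <-≤-trans (A-<-suc i) (A-mono-≤ i<j)

  n<A : ∀ n → n < A k n
  n<A zero    = A-positive 0
  n<A (suc n) = ≤-trans (s≤s (n<A n)) (A-<-suc n)

  τw^ : ℕ → List ℕ → List ℕ
  τw^ zero    w = w
  τw^ (suc m) w = τw k (τw^ m w)

  τw-++ : ∀ u v → τw k (u ++ v) ≡ τw k u ++ τw k v
  τw-++ = concatMap-++ (τ k)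

  τw^-++ : ∀ m u v → τw^ m (u ++ v) ≡ τw^ m u ++ τw^ m v
  τw^-++ zero    u v = refl
  τw^-++ (suc m) u v = trans (cong (τw k) (τw^-++ m u v)) (τw-++ (τw^ m u) (τw^ m v))

  τw^-+ : ∀ m n w → τw^ (m + n) w ≡ τw^ m (τw^ n w)
  τw^-+ zero    n w = refl
  τw^-+ (suc m) n w = cong (τw k) (τw^-+ m n w)

  iter≡τw^ : ∀ m → iter k m ≡ τw^ m (k ∷ [])
  iter≡τw^ zero    = refl
  iter≡τw^ (suc m) = cong (τw k) (iter≡τw^ m)

  τw-k : τw k (k ∷ []) ≡ k ∷ 1 ∷ []
  τw-k rewrite dec-true (k ≟ k) refl = refl

  τw-≢k : ∀ {i} → i ≢ k → τw k (i ∷ []) ≡ suc i ∷ []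
  τw-≢k {i} i≢k rewrite dec-false (i ≟ k) i≢k = refl

  τw^-1-≤ : ∀ {j} → j ≤ k' → τw^ j (1 ∷ []) ≡ suc j ∷ []
  τw^-1-≤ {zero}  _    = refl
  τw^-1-≤ {suc j} j<k' = trans (cong (τw k) (τw^-1-≤ (<⇒≤ j<k')))
                               (τw-≢k (λ sj≡k → <⇒≢ j<k' (suc-injective sj≡k)))

  τw^-1-≥ : ∀ {q} → k' ≤ q → τw^ q (1 ∷ []) ≡ iter k (q ∸ k')
  τw^-1-≥ {q} k'≤q = begin
    τw^ q (1 ∷ [])                 ≡⟨ cong (λ t → τw^ t (1 ∷ [])) (sym (m∸n+n≡m k'≤q)) ⟩
    τw^ (q ∸ k' + k') (1 ∷ [])     ≡⟨ τw^-+ (q ∸ k') k' (1 ∷ []) ⟩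
    τw^ (q ∸ k') (τw^ k' (1 ∷ [])) ≡⟨ cong (τw^ (q ∸ k')) (τw^-1-≤ ≤-refl) ⟩
    τw^ (q ∸ k') (k ∷ [])          ≡⟨ sym (iter≡τw^ (q ∸ k')) ⟩
    iter k (q ∸ k')                ∎
    where open ≡-Reasoning

  iter-suc : ∀ q → iter k (suc q) ≡ iter k q ++ τw^ q (1 ∷ [])
  iter-suc q = begin
    iter k (suc q)                     ≡⟨ iter≡τw^ (suc q) ⟩
    τw^ (suc q) (k ∷ [])               ≡⟨ cong (λ t → τw^ t (k ∷ [])) (+-comm 1 q) ⟩
    τw^ (q + 1) (k ∷ [])               ≡⟨ τw^-+ q 1 (k ∷ []) ⟩
    τw^ q (τw k (k ∷ []))              ≡⟨ cong (τw^ q) τw-k ⟩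
    τw^ q ((k ∷ []) ++ (1 ∷ []))       ≡⟨ τw^-++ q (k ∷ []) (1 ∷ []) ⟩
    τw^ q (k ∷ []) ++ τw^ q (1 ∷ [])   ≡⟨ cong (_++ τw^ q (1 ∷ [])) (sym (iter≡τw^ q)) ⟩
    iter k q ++ τw^ q (1 ∷ [])         ∎
    where open ≡-Reasoning

  iter-suc-< : ∀ {q} → q < k' → iter k (suc q) ≡ iter k q ++ suc q ∷ []
  iter-suc-< {q} q<k' = trans (iter-suc q) (cong (iter k q ++_) (τw^-1-≤ (<⇒≤ q<k')))

  iter-suc-≥ : ∀ {q} → k' ≤ q → iter k (suc q) ≡ iter k q ++ iter k (q ∸ k')
  iter-suc-≥ {q} k'≤q = trans (iter-suc q) (cong (iter k q ++_) (τw^-1-≥ k'≤q))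

  length-iter : ∀ q → length (iter k q) ≡ A k q
  length-iter = <-rec (λ q → length (iter k q) ≡ A k q) step
    where
    open ≡-Reasoning
    step : ∀ q → (∀ {j} → j < q → length (iter k j) ≡ A k j) → length (iter k q) ≡ A k q
    step zero    _  = refl
    step (suc q) ih with k' ≤? q
    ... | yes k'≤q = begin
      length (iter k (suc q))                         ≡⟨ cong length (iter-suc-≥ k'≤q) ⟩
      length (iter k q ++ iter k (q ∸ k'))            ≡⟨ length-++ (iter k q) ⟩
      length (iter k q) + length (iter k (q ∸ k'))    ≡⟨ cong₂ _+_ (ih ≤-refl) (ih (s≤s (m∸n≤m q k'))) ⟩
      A k q + A k (q ∸ k')                            ≡⟨ sym (A-suc-≥ k'≤q) ⟩
      A k (suc q)                                     ∎
    ... | no q≱k' = begin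
      length (iter k (suc q))                         ≡⟨ cong length (iter-suc-< (≰⇒> q≱k')) ⟩
      length (iter k q ++ suc q ∷ [])                 ≡⟨ length-++ (iter k q) ⟩
      length (iter k q) + 1                           ≡⟨ +-comm _ 1 ⟩
      suc (length (iter k q))                         ≡⟨ cong suc (ih ≤-refl) ⟩
      suc (A k q)                                     ≡⟨ sym (A-suc-< (≰⇒> q≱k')) ⟩
      A k (suc q)                                     ∎

  nth-++ˡ : ∀ u {v n} → n < length u → nth (u ++ v) n ≡ nth u n
  nth-++ˡ (a ∷ u) {n = zero}  _         = refl
  nth-++ˡ (a ∷ u) {n = suc n} (s≤s n<u) = nth-++ˡ u n<u

  nth-++ʳ : ∀ u {v} m → nth (u ++ v) (length u + m) ≡ nth v m
  nth-++ʳ []      m = refl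
  nth-++ʳ (a ∷ u) m = nth-++ʳ u m

  iter-prefix : ∀ {j j'} → j ≤ j' → ∃ λ r → iter k j' ≡ iter k j ++ r
  iter-prefix j≤j' = go (≤⇒≤′ j≤j')
    where
    go : ∀ {j j'} → j ≤′ j' → ∃ λ r → iter k j' ≡ iter k j ++ r
    go {j} ≤′-refl = [] , sym (++-identityʳ (iter k j))
    go {j} (≤′-step {j'} h) with go h
    ... | r , e = r ++ τw^ j' (1 ∷ []) ,
      trans (iter-suc j') (trans (cong (_++ τw^ j' (1 ∷ [])) e) (++-assoc (iter k j) r _))

  nth-iter-prefix : ∀ {j j' n} → j ≤ j' → n < length (iter k j) → nth (iter k j') n ≡ nth (iter k j) n
  nth-iter-prefix {j} {n = n} j≤j' n<u with iter-prefix j≤j'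
  ... | r , e = trans (cong (λ w → nth w n) e) (nth-++ˡ (iter k j) n<u)

  nth-iter : ∀ j {n} → n < length (iter k j) → nth (iter k j) n ≡ x k n
  nth-iter j {n} n<u with ≤-total j (suc n)
  ... | inj₁ j≤1+n = sym (nth-iter-prefix j≤1+n n<u)
  ... | inj₂ 1+n≤j = nth-iter-prefix 1+n≤j n<u'
    where
    n<u' : n < length (iter k (suc n))
    n<u' = <-≤-trans (<-trans (n<1+n n) (n<A (suc n))) (≤-reflexive (sym (length-iter (suc n))))

  head-iter : ∀ j → nth (iter k j) 0 ≡ k
  head-iter j = nth-iter-prefix {0} {j} z≤n (s≤s z≤n)

  0<length-iter : ∀ j → 0 < length (iter k j)
  0<length-iter j = <-≤-trans (A-positive j) (≤-reflexive (sym (length-iter j)))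

  x-A+ : ∀ q {w m} → iter k (suc q) ≡ iter k q ++ w → m < length w → x k (A k q + m) ≡ nth w m
  x-A+ q {w} {m} e m<w = begin
    x k (A k q + m)                             ≡⟨ sym (nth-iter (suc q) lt) ⟩
    nth (iter k (suc q)) (A k q + m)            ≡⟨ cong₂ nth e (cong (_+ m) (sym (length-iter q))) ⟩
    nth (iter k q ++ w) (length (iter k q) + m) ≡⟨ nth-++ʳ (iter k q) m ⟩
    nth w m                                     ∎
    where
    open ≡-Reasoning
    lt : A k q + m < length (iter k (suc q))
    lt = <-≤-trans (+-monoʳ-< (A k q) m<w) (≤-reflexive (sym
           (trans (cong length e) (trans (length-++ (iter k q)) (cong (_+ length w) (length-iter q))))))

  x-A : ∀ d → x k (A k d) ≡ k ⊓ suc d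
  x-A d with k' ≤? d
  ... | yes k'≤d = begin
    x k (A k d)             ≡⟨ cong (x k) (sym (+-identityʳ (A k d))) ⟩
    x k (A k d + 0)         ≡⟨ x-A+ d (iter-suc-≥ k'≤d) (0<length-iter (d ∸ k')) ⟩
    nth (iter k (d ∸ k')) 0 ≡⟨ head-iter (d ∸ k') ⟩
    k                       ≡⟨ sym (m≤n⇒m⊓n≡m (s≤s k'≤d)) ⟩
    k ⊓ suc d               ∎
    where open ≡-Reasoning
  ... | no d≱k' = begin
    x k (A k d)          ≡⟨ cong (x k) (sym (+-identityʳ (A k d))) ⟩
    x k (A k d + 0)      ≡⟨ x-A+ d (iter-suc-< (≰⇒> d≱k')) (s≤s z≤n) ⟩
    suc d                ≡⟨ sym (m≥n⇒m⊓n≡n (s≤s (<⇒≤ (≰⇒> d≱k')))) ⟩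
    k ⊓ suc d            ∎
    where open ≡-Reasoning

  x-shift : ∀ {e m} → k' ≤ e → m < A k (e ∸ k') → x k (A k e + m) ≡ x k m
  x-shift {e} {m} k'≤e m<A = trans (x-A+ e (iter-suc-≥ k'≤e) m<u) (nth-iter (e ∸ k') m<u)
    where
    m<u : m < length (iter k (e ∸ k'))
    m<u = <-≤-trans m<A (≤-reflexive (sym (length-iter (e ∸ k'))))

  weight : List ℕ → ℕ
  weight D = sum (map (A k) D)

  gap⇒<∸ : ∀ {e f} → e + k ≤ f → e < f ∸ k'
  gap⇒<∸ {e} e+k≤f = m+n≤o⇒m≤o∸n (suc e) (≤-trans (≤-reflexive (sym (+-suc e k'))) e+k≤f)

  gap⇒k'≤ : ∀ {e f} → e + k ≤ f → k' ≤ f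
  gap⇒k'≤ {e} e+k≤f = ≤-trans (≤-trans (n≤1+n k') (m≤n+m k e)) e+k≤f

  A+<A-suc : ∀ {e m} → k' ≤ e → m < A k (e ∸ k') → A k e + m < A k (suc e)
  A+<A-suc {e} k'≤e m<A = <-≤-trans (+-monoʳ-< (A k e) m<A) (≤-reflexive (sym (A-suc-≥ k'≤e)))

  x-drop-tail : ∀ e D {m} → Gapped k (e ∷ D) → k' ≤ e → m < A k (e ∸ k') →
                x k (m + weight (e ∷ D)) ≡ x k m
  x-drop-tail e [] {m} _ k'≤e m<A =
    trans (cong (x k) (trans (cong (m +_) (+-identityʳ (A k e))) (+-comm m (A k e)))) (x-shift k'≤e m<A)
  x-drop-tail e (f ∷ D) {m} (e+k≤f , gapped) k'≤e m<A = begin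
    x k (m + (A k e + weight (f ∷ D)))  ≡⟨ cong (x k) (rearrange m (A k e) (weight (f ∷ D))) ⟩
    x k (A k e + m + weight (f ∷ D))    ≡⟨ x-drop-tail f D gapped (gap⇒k'≤ e+k≤f) lt ⟩
    x k (A k e + m)                     ≡⟨ x-shift k'≤e m<A ⟩
    x k m                               ∎
    where
    open ≡-Reasoning
    rearrange : ∀ a b c → a + (b + c) ≡ b + a + c
    rearrange a b c = trans (sym (+-assoc a b c)) (cong (_+ c) (+-comm a b))
    lt : A k e + m < A k (f ∸ k')
    lt = <-≤-trans (A+<A-suc k'≤e m<A) (A-mono-≤ (gap⇒<∸ e+k≤f))

  x-rep : ∀ n D → Rep k n D → x k n ≡ minRank k D
  x-rep _ []          (_ , refl) = head-iter 1
  x-rep _ (d ∷ [])    (_ , refl) = trans (cong (x k) (+-identityʳ (A k d))) (x-A d)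
  x-rep _ (d ∷ e ∷ D) ((d+k≤e , gapped) , refl) =
    trans (x-drop-tail e D gapped (gap⇒k'≤ d+k≤e) (A-mono-< (gap⇒<∸ d+k≤e))) (x-A d)

  RepBelow : ℕ → ℕ → List ℕ → Set
  RepBelow r n D = Gapped k D × All (_< r) D × weight D ≡ n

  Gapped-snoc : ∀ D {c} → Gapped k D → All (λ e → e + k ≤ c) D → Gapped k (D ++ c ∷ [])
  Gapped-snoc []          _               _               = tt
  Gapped-snoc (a ∷ [])    _               (a+k≤c ∷ [])    = a+k≤c , tt
  Gapped-snoc (a ∷ b ∷ D) (a+k≤b , gapped) (_ ∷ b∷D+k≤c) = a+k≤b , Gapped-snoc (b ∷ D) gapped b∷D+k≤c

  weight-snoc : ∀ D c → weight (D ++ c ∷ []) ≡ weight D + A k c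
  weight-snoc D c = begin
    weight (D ++ c ∷ [])            ≡⟨ cong sum (map-++ (A k) D (c ∷ [])) ⟩
    sum (map (A k) D ++ A k c ∷ []) ≡⟨ sum-++ (map (A k) D) (A k c ∷ []) ⟩
    weight D + (A k c + 0)          ≡⟨ cong (weight D +_) (+-identityʳ (A k c)) ⟩
    weight D + A k c                ∎
    where open ≡-Reasoning

  RepBelow-mono : ∀ {r s n D} → r ≤ s → RepBelow r n D → RepBelow s n D
  RepBelow-mono r≤s (gapped , below , w≡n) = gapped , All.map (λ e<r → <-≤-trans e<r r≤s) below , w≡n

  RepBelow-snoc : ∀ {r n E} → k' ≤ r → A k r ≤ n → RepBelow (r ∸ k') (n ∸ A k r) E →
                  RepBelow (suc r) n (E ++ r ∷ [])
  RepBelow-snoc {r} {n} {E} k'≤r A≤n (gapped , below , w≡n∸A) =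
    Gapped-snoc E gapped (All.map gap below) ,
    ++⁺ (All.map (λ e<r∸k' → <-≤-trans e<r∸k' (≤-trans (m∸n≤m r k') (n≤1+n r))) below) (≤-refl ∷ []) ,
    trans (weight-snoc E r) (trans (cong (_+ A k r) w≡n∸A) (m∸n+n≡m A≤n))
    where
    gap : ∀ {e} → e < r ∸ k' → e + k ≤ r
    gap {e} e<r∸k' = ≤-trans (≤-reflexive (+-suc e k')) (m≤o∸n⇒m+n≤o (suc e) k'≤r e<r∸k')

  representation : ∀ r n → n < A k r → ∃ λ D → RepBelow r n D
  representation = <-rec (λ r → ∀ n → n < A k r → ∃ λ D → RepBelow r n D) step
    where
    step : ∀ r → (∀ {s} → s < r → ∀ n → n < A k s → ∃ λ D → RepBelow s n D) →
           ∀ n → n < A k r → ∃ λ D → RepBelow r n D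
    step zero    _  zero    _ = [] , tt , [] , refl
    step zero    _  (suc n) (s≤s ())
    step (suc r) ih n n<A with n <? A k r
    ... | yes n<Ar with ih ≤-refl n n<Ar
    ...   | D , rep = D , RepBelow-mono (n≤1+n r) rep
    step (suc r) ih n n<A | no n≮Ar with k' ≤? r
    ... | yes k'≤r with ih (s≤s (m∸n≤m r k')) (n ∸ A k r) rest<A
      where
      rest<A : n ∸ A k r < A k (r ∸ k')
      rest<A = <-≤-trans (∸-monoˡ-< (≤-trans n<A (≤-reflexive (A-suc-≥ k'≤r))) (≮⇒≥ n≮Ar))
                         (≤-reflexive (m+n∸m≡n (A k r) (A k (r ∸ k'))))
    ...   | E , rep = E ++ r ∷ [] , RepBelow-snoc k'≤r (≮⇒≥ n≮Ar) rep
    step (suc r) ih n n<A | no n≮Ar | no r≱k' =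
      r ∷ [] , tt , ≤-refl ∷ [] , trans (+-identityʳ (A k r)) n≡Ar
      where
      n≡Ar : A k r ≡ n
      n≡Ar = ≤-antisym (≮⇒≥ n≮Ar) (s≤s⁻¹ (≤-trans n<A (≤-reflexive (A-suc-< (≰⇒> r≱k')))))

theorem5p2 : (k : ℕ) → 1 ≤ k → (n : ℕ) →
    Σ (List ℕ) (λ D → Rep k n D)
    × ((D : List ℕ) → Rep k n D → x k n ≡ minRank k D)
theorem5p2 (suc k') _ n =
  let (D , gapped , _ , weight≡n) = representation k' n n (n<A k' n)
  in (D , gapped , weight≡n) , x-rep k' n
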